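{- Let $H$ be a graph with at least twelve vertices whose vertex set can be partitioned into two sets $A$ and $B$ such that: (i) $|A|,|B|\ge 3$; (ii) each of $H[A]$ and $H[B]$ has at most one edge; (iii) every vertex in $A$ has degree $r$ in $H$ for some $r\ge 1$, and every vertex in $B$ has degree $s$ in $H$ for some $s\ge 1$; (iv) every vertex in $A$ has a non-neighbor in $B$, and every vertex in $B$ has a non-neighbor in $A$. Then the complement $\overline{H}$ is 3-connected.
   Context: A graph is 3-connected if it is not disconnected by the removal of any set of at most two vertices (for a complete graph $K_n$ the vertex connectivity is $n-1$). $H[X]$ denotes the subgraph induced by $X$. -}

module Defs where

open import Data.Nat using (ℕ; _≤_; _≥_)
open import Data.Bool using (Bool; true; false)
open import Data.Fin using (Fin)
open import Data.Fin.Subset using (Subset; _∈_; _∉_; ∣_∣; ∁)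
open import Data.Vec using (tabulate)
open import Data.Product using (_×_; ∃; ∃-syntax)
open import Data.Sum using (_⊎_)
open import Relation.Binary.PropositionalEquality using (_≡_; _≢_)

record Graph (n : ℕ) : Set where
  field
    adj   : Fin n → Fin n → Bool
    sym   : ∀ u v → adj u v ≡ adj v u
    irrefl : ∀ u → adj u u ≡ false
open Graph public

nbhd : ∀ {n} → Graph n → Fin n → Subset n
nbhd G u = tabulate (adj G u)

degree : ∀ {n} → Graph n → Fin n → ℕ
degree G u = ∣ nbhd G u ∣

coAdj : ∀ {n} → Graph n → Fin n → Fin n → Set
coAdj G u v = u ≢ v × adj G u v ≡ false

data CoWalk {n} (G : Graph n) (S : Subset n) : Fin n → Fin n → Set where
  here : ∀ {u} → CoWalk G S u u
  step : ∀ {u w v} → coAdj G u w → w ∉ S → CoWalk G S w v → CoWalk G S u v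

ComplementThreeConnected : ∀ {n} → Graph n → Set
ComplementThreeConnected {n} G =
  n ≥ 4 ×
  (∀ (S : Subset n) → ∣ S ∣ ≤ 2 →
     ∀ u v → u ∉ S → v ∉ S → CoWalk G S u v)

AtMostOneEdgeIn : ∀ {n} → Graph n → Subset n → Set
AtMostOneEdgeIn {n} G X =
  ∀ (u v x y : Fin n) → u ∈ X → v ∈ X → x ∈ X → y ∈ X →
    adj G u v ≡ true → adj G x y ≡ true →
    (u ≡ x × v ≡ y) ⊎ (u ≡ y × v ≡ x)

RegularOn : ∀ {n} → Graph n → Subset n → ℕ → Set
RegularOn {n} G X r = ∀ (u : Fin n) → u ∈ X → degree G u ≡ r

HasNonNeighbourIn : ∀ {n} → Graph n → Subset n → Subset n → Set
HasNonNeighbourIn {n} G X Y =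
  ∀ (u : Fin n) → u ∈ X → ∃[ w ] (w ∈ Y × adj G u w ≡ false)

module Submission where

-- Write V = X ⊎ Y with X = A, Y = ∁ A, and let ∣ S ∣ ≤ 2.  Exploring the
-- complement of H − S from a vertex yields either the required walk or a
-- "complement cut": a split of V ∖ S into inhabited parts C, D such that H
-- contains every C–D edge (walk-or-cut).  No such cut exists (no-cut):
--   * Degrees: each side has a vertex with no neighbour on its side and a
--     non-neighbour on the other, so by regularity all degrees are ≤ n − 4,
--     and no vertex is H-adjacent to all of V ∖ S (that needs ≥ n − 3).
--   * No side is split: if C, D both meet X, the single edge of H[X] joins
--     them and X ∖ S is its two ends; then an end is adjacent to all of V ∖ S,
--     or Y ∖ S is a pair as well and n ≤ 6.
--   * Hence, up to symmetry, H contains all edges between X ∖ S and Y ∖ S.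
--     Then S = {w, z} for non-neighbours w ∈ Y, z ∈ X, deg z ≤ 2, and
--     regularity gives ∣ Y ∣ ≤ 3; likewise ∣ X ∣ ≤ 3, contradicting n ≥ 7.
-- Counting facts on finite subsets come first, then graph lemmas, the
-- exploration lemma, the cut analysis, and finally the theorem.

open import Defs
open import Data.Nat using (ℕ; zero; suc; _+_; _≤_; _≥_; _<_; z≤n; s≤s)
open import Data.Nat.Properties
  using (≤-trans; ≤-reflexive; <⇒≱; +-comm; +-suc; +-mono-≤; +-monoˡ-≤; +-monoʳ-≤; n≤1+n; m≤m+n;
         m+[n∸m]≡n; module ≤-Reasoning)
open import Data.Bool using (true; false)
open import Data.Bool.Properties using (not-¬; ¬-not) renaming (_≟_ to _≟ᵇ_)
open import Data.Fin using (Fin; _≟_)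
open import Data.Fin.Properties using (any?)
open import Data.Fin.Subset using (Subset; ∣_∣; ∁; _∈_; _∉_; _∪_; _⊆_; _-_; ⁅_⁆; inside; outside; Nonempty; ⊤)
open import Data.Fin.Subset.Properties
  using (_∈?_; nonempty?; Empty-unique; ∣⊥∣≡0; ∣⊤∣≡n; ∣⁅x⁆∣≡1; ∣p∣≤n; ∣∁p∣≡n∸∣p∣; p⊆q⇒∣p∣≤∣q∣; p⊂q⇒∣p∣<∣q∣;
         x∈p⇒∣p-x∣<∣p∣; x∈p∧x≢y⇒x∈p-y; x∈⁅x⁆; x∈⁅y⁆⇒x≡y; p⊆p∪q; q⊆p∪q; x∈p∪q⁻; x∉p⇒x∈∁p; x∈∁p⇒x∉p)
open import Data.Vec using ([]; _∷_; tabulate)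
open import Data.Vec.Properties using (lookup∘tabulate; lookup⇒[]=; []=⇒lookup)
open import Data.Product using (_×_; ∃-syntax; _,_; proj₁; proj₂)
open import Data.Sum using (_⊎_; inj₁; inj₂; [_,_]′) renaming (map to ⊎-map; swap to ⊎-swap)
open import Data.Empty using (⊥; ⊥-elim)
open import Function using (id; _∘_)
open import Relation.Nullary using (Dec; yes; no; ¬_; ¬?)
open import Relation.Nullary.Decidable using (_×-dec_)
open import Relation.Binary.PropositionalEquality
  using (_≡_; _≢_; refl; trans; cong; cong₂; subst; ≢-sym) renaming (sym to ≡-sym)

-- Counting in finite subsets.

≡⇒∈⁅⁆ : ∀ {n} {x y : Fin n} → x ≡ y → x ∈ ⁅ y ⁆
≡⇒∈⁅⁆ refl = x∈⁅x⁆ _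

∈pair : ∀ {n} {x a b : Fin n} → x ≡ a ⊎ x ≡ b → x ∈ ⁅ a ⁆ ∪ ⁅ b ⁆
∈pair {a = a} {b} (inj₁ x≡a) = p⊆p∪q ⁅ b ⁆ (≡⇒∈⁅⁆ x≡a)
∈pair {a = a} {b} (inj₂ x≡b) = q⊆p∪q ⁅ a ⁆ ⁅ b ⁆ (≡⇒∈⁅⁆ x≡b)

∣p∪q∣≤∣p∣+∣q∣ : ∀ {n} (p q : Subset n) → ∣ p ∪ q ∣ ≤ ∣ p ∣ + ∣ q ∣
∣p∪q∣≤∣p∣+∣q∣ []            []            = z≤n
∣p∪q∣≤∣p∣+∣q∣ (outside ∷ p) (outside ∷ q) = ∣p∪q∣≤∣p∣+∣q∣ p q
∣p∪q∣≤∣p∣+∣q∣ (outside ∷ p) (inside  ∷ q) =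
  ≤-trans (s≤s (∣p∪q∣≤∣p∣+∣q∣ p q)) (≤-reflexive (≡-sym (+-suc ∣ p ∣ ∣ q ∣)))
∣p∪q∣≤∣p∣+∣q∣ (inside  ∷ p) (outside ∷ q) = s≤s (∣p∪q∣≤∣p∣+∣q∣ p q)
∣p∪q∣≤∣p∣+∣q∣ (inside  ∷ p) (inside  ∷ q) =
  s≤s (≤-trans (∣p∪q∣≤∣p∣+∣q∣ p q) (+-monoʳ-≤ ∣ p ∣ (n≤1+n ∣ q ∣)))

∣⁅a⁆∪⁅b⁆∣≤2 : ∀ {n} (a b : Fin n) → ∣ ⁅ a ⁆ ∪ ⁅ b ⁆ ∣ ≤ 2
∣⁅a⁆∪⁅b⁆∣≤2 a b =
  subst (∣ ⁅ a ⁆ ∪ ⁅ b ⁆ ∣ ≤_) (cong₂ _+_ (∣⁅x⁆∣≡1 a) (∣⁅x⁆∣≡1 b)) (∣p∪q∣≤∣p∣+∣q∣ ⁅ a ⁆ ⁅ b ⁆)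

∣p∣<∣p∪⁅x⁆∣ : ∀ {n} {p : Subset n} {x} → x ∉ p → ∣ p ∣ < ∣ p ∪ ⁅ x ⁆ ∣
∣p∣<∣p∪⁅x⁆∣ {p = p} {x} x∉p = p⊂q⇒∣p∣<∣q∣ (p⊆p∪q ⁅ x ⁆ , x , q⊆p∪q p ⁅ x ⁆ (x∈⁅x⁆ x) , x∉p)

full⇒n≤∣p∣ : ∀ {n} (p : Subset n) → (∀ x → x ∈ p) → n ≤ ∣ p ∣
full⇒n≤∣p∣ {n} p full = subst (_≤ ∣ p ∣) (∣⊤∣≡n n) (p⊆q⇒∣p∣≤∣q∣ {p = ⊤} (λ {x} _ → full x))

nonempty : ∀ {n} (p : Subset n) → 0 < ∣ p ∣ → Nonempty p
nonempty {n} p 0<∣p∣ with nonempty? p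
... | yes p≠∅ = p≠∅
... | no  p=∅ = ⊥-elim (<⇒≱ 0<∣p∣ (≤-reflexive (trans (cong ∣_∣ (Empty-unique p=∅)) (∣⊥∣≡0 n))))

-- Three distinct members force size at least three: removing them one by
-- one strictly decreases the size each time.
three-members : ∀ {n} {p : Subset n} {a b c} → a ∈ p → b ∈ p → c ∈ p →
                a ≢ b → a ≢ c → b ≢ c → 3 ≤ ∣ p ∣
three-members {p = p} {a} {b} {c} a∈p b∈p c∈p a≢b a≢c b≢c =
  ≤-trans (s≤s (≤-trans (s≤s (≤-trans (s≤s z≤n) (x∈p⇒∣p-x∣<∣p∣ c∈p-a-b)))
                        (x∈p⇒∣p-x∣<∣p∣ b∈p-a)))
          (x∈p⇒∣p-x∣<∣p∣ a∈p)
  where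
  b∈p-a : b ∈ p - a
  b∈p-a = x∈p∧x≢y⇒x∈p-y b∈p (≢-sym a≢b)
  c∈p-a-b : c ∈ p - a - b
  c∈p-a-b = x∈p∧x≢y⇒x∈p-y (x∈p∧x≢y⇒x∈p-y c∈p (≢-sym a≢c)) (≢-sym b≢c)

only-two : ∀ {n} {p : Subset n} {a b} → ∣ p ∣ ≤ 2 → a ∈ p → b ∈ p → a ≢ b →
           ∀ {x} → x ∈ p → x ≡ a ⊎ x ≡ b
only-two {a = a} {b} ∣p∣≤2 a∈p b∈p a≢b {x} x∈p with x ≟ a | x ≟ b
... | yes x≡a | _       = inj₁ x≡a
... | no  _   | yes x≡b = inj₂ x≡b
... | no  x≢a | no  x≢b =
  ⊥-elim (<⇒≱ (s≤s ∣p∣≤2) (three-members a∈p b∈p x∈p a≢b (≢-sym x≢a) (≢-sym x≢b)))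

avoid-two : ∀ {n} (p : Subset n) → 3 ≤ ∣ p ∣ → ∀ a b → ∃[ x ] (x ∈ p × x ≢ a × x ≢ b)
avoid-two p 3≤∣p∣ a b with any? (λ x → (x ∈? p) ×-dec ¬? (x ≟ a) ×-dec ¬? (x ≟ b))
... | yes found = found
... | no  none  = ⊥-elim (<⇒≱ 3≤∣p∣ (≤-trans (p⊆q⇒∣p∣≤∣q∣ p⊆ab) (∣⁅a⁆∪⁅b⁆∣≤2 a b)))
  where
  p⊆ab : p ⊆ ⁅ a ⁆ ∪ ⁅ b ⁆
  p⊆ab {x} x∈p with x ≟ a | x ≟ b
  ... | yes x≡a | _       = ∈pair (inj₁ x≡a)
  ... | no  _   | yes x≡b = ∈pair (inj₂ x≡b)
  ... | no  x≢a | no  x≢b = ⊥-elim (none (x , x∈p , x≢a , x≢b))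

∈-or-∈∁ : ∀ {n} (p : Subset n) x → x ∈ p ⊎ x ∈ ∁ p
∈-or-∈∁ p x with x ∈? p
... | yes x∈p = inj₁ x∈p
... | no  x∉p = inj₂ (x∉p⇒x∈∁p x∉p)

∣p∣+∣∁p∣≡n : ∀ {n} (p : Subset n) → ∣ p ∣ + ∣ ∁ p ∣ ≡ n
∣p∣+∣∁p∣≡n p = trans (cong (∣ p ∣ +_) (∣∁p∣≡n∸∣p∣ p)) (m+[n∸m]≡n (∣p∣≤n p))

-- Neighbourhoods, sparse vertex sets and degrees in an arbitrary graph.

∈nbhd⁺ : ∀ {n} (G : Graph n) {u x} → adj G u x ≡ true → x ∈ nbhd G u
∈nbhd⁺ G {u} {x} ux = lookup⇒[]= x (tabulate (adj G u)) (trans (lookup∘tabulate (adj G u) x) ux)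

∈nbhd⁻ : ∀ {n} (G : Graph n) {u x} → x ∈ nbhd G u → adj G u x ≡ true
∈nbhd⁻ G {u} {x} x∈N = trans (≡-sym (lookup∘tabulate (adj G u) x)) ([]=⇒lookup x∈N)

unique-neighbour : ∀ {n} (G : Graph n) {X} → AtMostOneEdgeIn G X →
                   ∀ {z} → z ∈ X → ∃[ t ] (∀ {y} → y ∈ X → adj G z y ≡ true → y ≡ t)
unique-neighbour G {X} sparse {z} z∈X with any? (λ y → (y ∈? X) ×-dec (adj G z y ≟ᵇ true))
... | no  none            = z , λ y∈X zy → ⊥-elim (none (_ , y∈X , zy))
... | yes (t , t∈X , zt) = t , λ y∈X zy → only-t (sparse _ _ _ t z∈X y∈X z∈X t∈X zy zt)
  where
  only-t : ∀ {y} → (z ≡ z × y ≡ t) ⊎ (z ≡ t × y ≡ z) → y ≡ t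
  only-t (inj₁ (_ , y≡t))   = y≡t
  only-t (inj₂ (z≡t , y≡z)) = trans y≡z z≡t

-- A set of at least three vertices spanning at most one edge contains a
-- vertex with no neighbour in the set: a vertex off the edge, if any.
isolated-vertex : ∀ {n} (G : Graph n) {X} → AtMostOneEdgeIn G X → 3 ≤ ∣ X ∣ →
                  ∃[ a ] (a ∈ X × ∀ {y} → y ∈ X → adj G a y ≢ true)
isolated-vertex G {X} sparse 3≤∣X∣ with nonempty X (≤-trans (s≤s z≤n) 3≤∣X∣)
... | x₁ , x₁∈X with any? (λ y → (y ∈? X) ×-dec (adj G x₁ y ≟ᵇ true))
...   | no none = x₁ , x₁∈X , λ y∈X x₁y → none (_ , y∈X , x₁y)
...   | yes (x₂ , x₂∈X , x₁x₂) with avoid-two X 3≤∣X∣ x₁ x₂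
...     | x₃ , x₃∈X , x₃≢x₁ , x₃≢x₂ = x₃ , x₃∈X , λ y∈X x₃y →
  [ x₃≢x₁ ∘ proj₁ , x₃≢x₂ ∘ proj₁ ]′ (sparse _ _ _ _ x₃∈X y∈X x₁∈X x₂∈X x₃y x₁x₂)

hub-degree : ∀ {n} (G : Graph n) (S : Subset n) x →
             (∀ z → z ∉ S → z ≢ x → adj G x z ≡ true) → n ≤ suc (∣ S ∣ + degree G x)
hub-degree G S x adjacent =
  ≤-trans (full⇒n≤∣p∣ _ covered)
          (≤-trans (∣p∪q∣≤∣p∣+∣q∣ ⁅ x ⁆ _)
                   (+-mono-≤ (≤-reflexive (∣⁅x⁆∣≡1 x)) (∣p∪q∣≤∣p∣+∣q∣ S (nbhd G x))))
  where
  covered : ∀ z → z ∈ ⁅ x ⁆ ∪ (S ∪ nbhd G x)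
  covered z with z ≟ x | z ∈? S
  ... | yes z≡x | _       = p⊆p∪q _ (≡⇒∈⁅⁆ z≡x)
  ... | no  _   | yes z∈S = q⊆p∪q ⁅ x ⁆ _ (p⊆p∪q _ z∈S)
  ... | no  z≢x | no  z∉S = q⊆p∪q ⁅ x ⁆ _ (q⊆p∪q S _ (∈nbhd⁺ G (adjacent z z∉S z≢x)))

forced-into-S : ∀ {n} (G : Graph n) {S : Subset n} {x y} →
                (y ∉ S → adj G x y ≡ true) → adj G x y ≡ false → y ∈ S
forced-into-S G {S} {y = y} must xy with y ∈? S
... | yes y∈S = y∈S
... | no  y∉S = ⊥-elim (not-¬ (must y∉S) xy)

-- Walks in the complement of G − S, and cuts obstructing them.

snoc : ∀ {n} {G : Graph n} {S a x y} → CoWalk G S a x → coAdj G x y → y ∉ S → CoWalk G S a y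
snoc here              xy y∉S = step xy y∉S here
snoc (step aw w∉S wx) xy y∉S = step aw w∉S (snoc wx xy y∉S)

coAdj? : ∀ {n} (G : Graph n) x y → Dec (coAdj G x y)
coAdj? G x y = ¬? (x ≟ y) ×-dec (adj G x y ≟ᵇ false)

-- The vertices outside S are split into inhabited parts C and D, and G
-- contains every edge between C and D; then the complement of G − S is
-- disconnected.
record ComplementCut {n} (G : Graph n) (S : Subset n) : Set where
  field
    C D      : Subset n
    covers   : ∀ x → x ∉ S → x ∈ C ⊎ x ∈ D
    complete : ∀ {x y} → x ∈ C → y ∈ D → adj G x y ≡ true
    c d      : Fin n
    c∈C      : c ∈ C
    d∈D      : d ∈ D
    c∉S      : c ∉ S
    d∉S      : d ∉ S
open ComplementCut

swapCut : ∀ {n} {G : Graph n} {S} → ComplementCut G S → ComplementCut G S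
swapCut {G = G} κ = record
  { C = D κ ; D = C κ ; covers = λ x x∉S → ⊎-swap (covers κ x x∉S)
  ; complete = λ {x} {y} x∈D y∈C → trans (Graph.sym G x y) (complete κ y∈C x∈D)
  ; c = d κ ; d = c κ ; c∈C = d∈D κ ; d∈D = c∈C κ ; c∉S = d∉S κ ; d∉S = c∉S κ }

module Exploration {n} (G : Graph n) (S : Subset n) (u : Fin n) (u∉S : u ∉ S) where

  Explored : Subset n → Set
  Explored R = ∀ {x} → x ∈ R → x ∉ S × CoWalk G S u x

  Frontier : Subset n → Fin n → Set
  Frontier R y = y ∉ S × y ∉ R × ∃[ x ] (x ∈ R × coAdj G x y)

  frontier? : ∀ R → Dec (∃[ y ] Frontier R y)
  frontier? R = any? λ y →
    ¬? (y ∈? S) ×-dec ¬? (y ∈? R) ×-dec any? (λ x → (x ∈? R) ×-dec coAdj? G x y)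

  closed⇒cut : ∀ {R v} → u ∈ R → ¬ (∃[ y ] Frontier R y) → v ∉ S → v ∉ R → ComplementCut G S
  closed⇒cut {R} {v} u∈R closed v∉S v∉R = record
    { C = R ; D = ∁ (R ∪ S) ; covers = split ; complete = edge
    ; c = u ; d = v ; c∈C = u∈R ; d∈D = outside-both v∉R v∉S ; c∉S = u∉S ; d∉S = v∉S }
    where
    outside-both : ∀ {y} → y ∉ R → y ∉ S → y ∈ ∁ (R ∪ S)
    outside-both y∉R y∉S = x∉p⇒x∈∁p ([ y∉R , y∉S ]′ ∘ x∈p∪q⁻ R S)
    split : ∀ x → x ∉ S → x ∈ R ⊎ x ∈ ∁ (R ∪ S)
    split x x∉S with x ∈? R
    ... | yes x∈R = inj₁ x∈R
    ... | no  x∉R = inj₂ (outside-both x∉R x∉S)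
    edge : ∀ {x y} → x ∈ R → y ∈ ∁ (R ∪ S) → adj G x y ≡ true
    edge {x} {y} x∈R y∈D with adj G x y ≟ᵇ false
    ... | no  xy≢false = ¬-not xy≢false
    ... | yes xy≡false = ⊥-elim (closed (y , y∉S , y∉R , x , x∈R , x≢y , xy≡false))
      where
      y∉R∪S : y ∉ R ∪ S
      y∉R∪S = x∈∁p⇒x∉p y∈D
      y∉S : y ∉ S
      y∉S = y∉R∪S ∘ q⊆p∪q R S
      y∉R : y ∉ R
      y∉R = y∉R∪S ∘ p⊆p∪q S
      x≢y : x ≢ y
      x≢y x≡y = y∉R (subst (_∈ R) x≡y x∈R)

  -- Grow an explored set by one frontier vertex at a time; the fuel k
  -- bounds the number of vertices that can still be added.
  explore : ∀ k R {v} → v ∉ S → u ∈ R → Explored R → n ≤ k + ∣ R ∣ →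
            CoWalk G S u v ⊎ ComplementCut G S
  explore k R {v} v∉S u∈R explored bound with frontier? R
  ... | no closed with v ∈? R
  ...   | yes v∈R = inj₁ (proj₂ (explored v∈R))
  ...   | no  v∉R = inj₂ (closed⇒cut u∈R closed v∉S v∉R)
  explore zero R v∉S u∈R explored bound | yes (y , _ , y∉R , _) =
    ⊥-elim (<⇒≱ (≤-trans (∣p∣<∣p∪⁅x⁆∣ y∉R) (∣p∣≤n (R ∪ ⁅ y ⁆))) bound)
  explore (suc k) R v∉S u∈R explored bound | yes (y , y∉S , y∉R , x , x∈R , xy) =
    explore k (R ∪ ⁅ y ⁆) v∉S (p⊆p∪q ⁅ y ⁆ u∈R) explored′
      (≤-trans bound (≤-trans (≤-reflexive (≡-sym (+-suc k ∣ R ∣))) (+-monoʳ-≤ k (∣p∣<∣p∪⁅x⁆∣ y∉R))))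
    where
    explored′ : Explored (R ∪ ⁅ y ⁆)
    explored′ {z} z∈R∪y with x∈p∪q⁻ R ⁅ y ⁆ z∈R∪y
    ... | inj₁ z∈R = explored z∈R
    ... | inj₂ z∈y rewrite x∈⁅y⁆⇒x≡y y z∈y = y∉S , snoc (proj₂ (explored x∈R)) xy y∉S

walk-or-cut : ∀ {n} (G : Graph n) (S : Subset n) u v → u ∉ S → v ∉ S →
              CoWalk G S u v ⊎ ComplementCut G S
walk-or-cut {n} G S u v u∉S v∉S =
  explore n ⁅ u ⁆ v∉S (x∈⁅x⁆ u) start (m≤m+n n ∣ ⁅ u ⁆ ∣)
  where
  open Exploration G S u u∉S
  start : Explored ⁅ u ⁆
  start u′∈⁅u⁆ rewrite x∈⁅y⁆⇒x≡y u u′∈⁅u⁆ = u∉S , here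

-- If a cut separates two vertices p ∈ C, q ∈ D of a set X spanning at most
-- one edge, then every other vertex of X has been deleted: a surviving
-- vertex of X would form a second edge with p or with q.
split-set-is-pair : ∀ {n} {G : Graph n} {S X} → AtMostOneEdgeIn G X → (κ : ComplementCut G S) →
                    ∀ {p q} → p ∈ X → p ∈ C κ → q ∈ X → q ∈ D κ →
                    ∀ {z} → z ∈ X → z ∉ S → z ≡ p ⊎ z ≡ q
split-set-is-pair sparse κ p∈X p∈C q∈X q∈D {z} z∈X z∉S with covers κ z z∉S
... | inj₁ z∈C = ⊎-map proj₁ proj₁
      (sparse _ _ _ _ z∈X q∈X p∈X q∈X (complete κ z∈C q∈D) (complete κ p∈C q∈D))
... | inj₂ z∈D = ⊎-swap (⊎-map proj₂ proj₂
      (sparse _ _ _ _ p∈X z∈X p∈X q∈X (complete κ p∈C z∈D) (complete κ p∈C q∈D)))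

-- The hypotheses of the theorem, stated symmetrically in the two sides X, Y.
record SparseBipartition {n} (H : Graph n) (X Y : Subset n) : Set where
  field
    partition      : ∀ x → x ∈ X ⊎ x ∈ Y
    disjoint       : ∀ {x} → x ∈ X → x ∉ Y
    sizes          : ∣ X ∣ + ∣ Y ∣ ≡ n
    large-X        : 3 ≤ ∣ X ∣
    large-Y        : 3 ≤ ∣ Y ∣
    sparse-X       : AtMostOneEdgeIn H X
    sparse-Y       : AtMostOneEdgeIn H Y
    regular-X      : ∃[ r ] RegularOn H X r
    regular-Y      : ∃[ s ] RegularOn H Y s
    nonNeighbour-X : HasNonNeighbourIn H X Y
    nonNeighbour-Y : HasNonNeighbourIn H Y X
open SparseBipartition

flipBipartition : ∀ {n} {H : Graph n} {X Y} → SparseBipartition H X Y → SparseBipartition H Y X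
flipBipartition {X = X} {Y} σ = record
  { partition = ⊎-swap ∘ partition σ ; disjoint = λ y∈Y y∈X → disjoint σ y∈X y∈Y
  ; sizes = trans (+-comm ∣ Y ∣ ∣ X ∣) (sizes σ) ; large-X = large-Y σ ; large-Y = large-X σ
  ; sparse-X = sparse-Y σ ; sparse-Y = sparse-X σ ; regular-X = regular-Y σ ; regular-Y = regular-X σ
  ; nonNeighbour-X = nonNeighbour-Y σ ; nonNeighbour-Y = nonNeighbour-X σ }

module _ {n} (H : Graph n) where

  same-degree : ∀ {X Y} → SparseBipartition H X Y → ∀ {x x′} → x ∈ X → x′ ∈ X →
                degree H x ≡ degree H x′
  same-degree σ {x} {x′} x∈X x′∈X =
    trans (proj₂ (regular-X σ) x x∈X) (≡-sym (proj₂ (regular-X σ) x′ x′∈X))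

  -- A vertex without neighbours in X that misses some w ∈ Y has all its
  -- neighbours in Y − w, so its degree is less than ∣ Y ∣.
  degree<∣Y∣ : ∀ {X Y} → SparseBipartition H X Y → ∀ {a w} →
               (∀ {y} → y ∈ X → adj H a y ≢ true) → w ∈ Y → adj H a w ≡ false → degree H a < ∣ Y ∣
  degree<∣Y∣ {X} {Y} σ {a} {w} isolated w∈Y aw =
    ≤-trans (s≤s (p⊆q⇒∣p∣≤∣q∣ N[a]⊆Y-w)) (x∈p⇒∣p-x∣<∣p∣ w∈Y)
    where
    N[a]⊆Y-w : nbhd H a ⊆ Y - w
    N[a]⊆Y-w {y} y∈N with partition σ y
    ... | inj₁ y∈X = ⊥-elim (isolated y∈X (∈nbhd⁻ H y∈N))
    ... | inj₂ y∈Y = x∈p∧x≢y⇒x∈p-y y∈Y λ y≡w →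
      not-¬ (∈nbhd⁻ H y∈N) (subst (λ k → adj H a k ≡ false) (≡-sym y≡w) aw)

  -- Every vertex of X has degree at most n − 4: by regularity its degree is
  -- that of an isolated vertex of H[X], which is below ∣ Y ∣ = n − ∣ X ∣ ≤ n − 3.
  degree-bound-X : ∀ {X Y} → SparseBipartition H X Y → ∀ {x} → x ∈ X → 4 + degree H x ≤ n
  degree-bound-X {X} {Y} σ {x} x∈X with isolated-vertex H (sparse-X σ) (large-X σ)
  ... | a , a∈X , isolated with nonNeighbour-X σ a a∈X
  ...   | w , w∈Y , aw = begin
    4 + degree H x   ≡⟨ cong (4 +_) (same-degree σ x∈X a∈X) ⟩
    3 + suc (degree H a) ≤⟨ +-mono-≤ (large-X σ) (degree<∣Y∣ σ isolated w∈Y aw) ⟩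
    ∣ X ∣ + ∣ Y ∣      ≡⟨ sizes σ ⟩
    n                ∎
    where open ≤-Reasoning

  degree-bound : ∀ {X Y} → SparseBipartition H X Y → ∀ x → 4 + degree H x ≤ n
  degree-bound σ x = [ degree-bound-X σ , degree-bound-X (flipBipartition σ) ]′ (partition σ x)

  module _ (7≤n : 7 ≤ n) (S : Subset n) (∣S∣≤2 : ∣ S ∣ ≤ 2) where

    -- No vertex is adjacent to all vertices outside S: its degree would be
    -- at least n − 3.
    no-hub : ∀ {X Y} → SparseBipartition H X Y → ∀ x → ¬ (∀ z → z ∉ S → z ≢ x → adj H x z ≡ true)
    no-hub σ x adjacent =
      <⇒≱ (degree-bound σ x) (≤-trans (hub-degree H S x adjacent) (s≤s (+-monoˡ-≤ (degree H x) ∣S∣≤2)))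

    -- If a cut splits X as p ∈ C, q ∈ D, and no surviving vertex of Y lies
    -- in C, then every surviving vertex other than p lies in D, so p is a hub.
    split-side-hub : ∀ {X Y} → SparseBipartition H X Y → (κ : ComplementCut H S) →
                     ∀ {p q} → p ∈ X → p ∈ C κ → q ∈ X → q ∈ D κ →
                     ¬ (∃[ y ] (y ∈ Y × y ∉ S × y ∈ C κ)) →
                     ∀ z → z ∉ S → z ≢ p → adj H p z ≡ true
    split-side-hub σ κ {p} {q} p∈X p∈C q∈X q∈D noneInC z z∉S z≢p = complete κ p∈C z∈D
      where
      z∈D : z ∈ D κ
      z∈D with partition σ z
      ... | inj₁ z∈X = [ ⊥-elim ∘ z≢p , (λ z≡q → subst (_∈ D κ) (≡-sym z≡q) q∈D) ]′
                         (split-set-is-pair (sparse-X σ) κ p∈X p∈C q∈X q∈D z∈X z∉S)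
      ... | inj₂ z∈Y = [ (λ z∈C → ⊥-elim (noneInC (z , z∈Y , z∉S , z∈C))) , id ]′ (covers κ z z∉S)

    -- A cut never splits one side: otherwise one of the two separated
    -- vertices is a hub, or both sides keep only two vertices and n ≤ 6.
    no-split : ∀ {X Y} → SparseBipartition H X Y → (κ : ComplementCut H S) →
               ∀ {p q} → p ∈ X → p ∈ C κ → q ∈ X → q ∈ D κ → ⊥
    no-split {X} {Y} σ κ {p} {q} p∈X p∈C q∈X q∈D
      with any? (λ y → (y ∈? Y) ×-dec ¬? (y ∈? S) ×-dec (y ∈? C κ))
    ... | no noneInC = no-hub σ p (split-side-hub σ κ p∈X p∈C q∈X q∈D noneInC)
    ... | yes (p′ , p′∈Y , _ , p′∈C) with any? (λ y → (y ∈? Y) ×-dec ¬? (y ∈? S) ×-dec (y ∈? D κ))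
    ...   | no noneInD = no-hub σ q (split-side-hub σ (swapCut κ) q∈X q∈D p∈X p∈C noneInD)
    ...   | yes (q′ , q′∈Y , _ , q′∈D) = <⇒≱ 7≤n (begin
      n                                          ≤⟨ full⇒n≤∣p∣ _ covered ⟩
      ∣ S ∪ (⁅ p ⁆ ∪ ⁅ q ⁆) ∪ (⁅ p′ ⁆ ∪ ⁅ q′ ⁆) ∣  ≤⟨ ∣p∪q∣≤∣p∣+∣q∣ S _ ⟩
      ∣ S ∣ + ∣ (⁅ p ⁆ ∪ ⁅ q ⁆) ∪ (⁅ p′ ⁆ ∪ ⁅ q′ ⁆) ∣  ≤⟨ +-monoʳ-≤ ∣ S ∣ (∣p∪q∣≤∣p∣+∣q∣ (⁅ p ⁆ ∪ ⁅ q ⁆) _) ⟩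
      ∣ S ∣ + (∣ ⁅ p ⁆ ∪ ⁅ q ⁆ ∣ + ∣ ⁅ p′ ⁆ ∪ ⁅ q′ ⁆ ∣)
        ≤⟨ +-mono-≤ ∣S∣≤2 (+-mono-≤ (∣⁅a⁆∪⁅b⁆∣≤2 p q) (∣⁅a⁆∪⁅b⁆∣≤2 p′ q′)) ⟩
      6                                          ∎)
      where
      open ≤-Reasoning
      covered : ∀ z → z ∈ S ∪ (⁅ p ⁆ ∪ ⁅ q ⁆) ∪ (⁅ p′ ⁆ ∪ ⁅ q′ ⁆)
      covered z with z ∈? S | partition σ z
      ... | yes z∈S | _ = p⊆p∪q _ z∈S
      ... | no z∉S | inj₁ z∈X =
        q⊆p∪q S _ (p⊆p∪q _ (∈pair (split-set-is-pair (sparse-X σ) κ p∈X p∈C q∈X q∈D z∈X z∉S)))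
      ... | no z∉S | inj₂ z∈Y =
        q⊆p∪q S _ (q⊆p∪q _ _ (∈pair (split-set-is-pair (sparse-Y σ) κ p′∈Y p′∈C q′∈Y q′∈D z∈Y z∉S)))

    -- If H contains all edges between X ∖ S and Y ∖ S (both nonempty), then
    -- ∣ Y ∣ ≤ 3.  The non-neighbours w ∈ Y of x₀ and z ∈ X of y₀ are
    -- deleted, so S = {w, z}; every surviving y ∈ Y has its non-neighbour in
    -- S ∩ X = {z}, so z has at most the neighbours w and one vertex of X;
    -- finally Y ⊆ N(x₀) ∪ {w} and deg x₀ = deg z ≤ 2.
    joined-sides-small : ∀ {X Y} → SparseBipartition H X Y →
                         (∀ {x y} → x ∈ X → x ∉ S → y ∈ Y → y ∉ S → adj H x y ≡ true) →
                         ∀ {x₀ y₀} → x₀ ∈ X → x₀ ∉ S → y₀ ∈ Y → y₀ ∉ S → ∣ Y ∣ ≤ 3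
    joined-sides-small {X} {Y} σ joined {x₀} {y₀} x₀∈X x₀∉S y₀∈Y y₀∉S
      with nonNeighbour-X σ x₀ x₀∈X | nonNeighbour-Y σ y₀ y₀∈Y
    ... | w , w∈Y , x₀w | z , z∈X , y₀z with unique-neighbour H (sparse-X σ) z∈X
    ...   | t , only-t = begin
      ∣ Y ∣                      ≤⟨ p⊆q⇒∣p∣≤∣q∣ Y⊆N[x₀]∪w ⟩
      ∣ nbhd H x₀ ∪ ⁅ w ⁆ ∣      ≤⟨ ∣p∪q∣≤∣p∣+∣q∣ (nbhd H x₀) ⁅ w ⁆ ⟩
      degree H x₀ + ∣ ⁅ w ⁆ ∣    ≡⟨ cong₂ _+_ (same-degree σ x₀∈X z∈X) (∣⁅x⁆∣≡1 w) ⟩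
      degree H z + 1            ≤⟨ +-monoˡ-≤ 1 (≤-trans (p⊆q⇒∣p∣≤∣q∣ N[z]⊆w∪t) (∣⁅a⁆∪⁅b⁆∣≤2 w t)) ⟩
      3                         ∎
      where
      open ≤-Reasoning
      joined′ : ∀ {y x} → y ∈ Y → y ∉ S → x ∈ X → x ∉ S → adj H y x ≡ true
      joined′ {y} {x} y∈Y y∉S x∈X x∉S = trans (Graph.sym H y x) (joined x∈X x∉S y∈Y y∉S)
      S⊆wz : ∀ {y} → y ∈ S → y ≡ w ⊎ y ≡ z
      S⊆wz = only-two ∣S∣≤2 (forced-into-S H (joined x₀∈X x₀∉S w∈Y) x₀w)
                            (forced-into-S H (joined′ y₀∈Y y₀∉S z∈X) y₀z)
                            (λ w≡z → disjoint σ z∈X (subst (_∈ Y) w≡z w∈Y))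
      S∩Y⊆w : ∀ {y} → y ∈ Y → y ∈ S → y ≡ w
      S∩Y⊆w y∈Y y∈S = [ id , (λ y≡z → ⊥-elim (disjoint σ (subst (_∈ X) (≡-sym y≡z) z∈X) y∈Y)) ]′ (S⊆wz y∈S)
      S∩X⊆z : ∀ {x} → x ∈ X → x ∈ S → x ≡ z
      S∩X⊆z x∈X x∈S = [ (λ x≡w → ⊥-elim (disjoint σ x∈X (subst (_∈ Y) (≡-sym x≡w) w∈Y))) , id ]′ (S⊆wz x∈S)
      -- The non-neighbour in X of a surviving y ∈ Y is deleted, hence is z.
      survivor-misses-z : ∀ {y} → y ∈ Y → y ∉ S → adj H z y ≢ true
      survivor-misses-z {y} y∈Y y∉S zy with nonNeighbour-Y σ y y∈Y
      ... | a , a∈X , ya = not-¬ (trans (Graph.sym H y z) zy)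
        (subst (λ k → adj H y k ≡ false) (S∩X⊆z a∈X (forced-into-S H (joined′ y∈Y y∉S a∈X) ya)) ya)
      N[z]⊆w∪t : nbhd H z ⊆ ⁅ w ⁆ ∪ ⁅ t ⁆
      N[z]⊆w∪t {y} y∈N with partition σ y
      ... | inj₁ y∈X = ∈pair (inj₂ (only-t y∈X (∈nbhd⁻ H y∈N)))
      ... | inj₂ y∈Y with y ∈? S
      ...   | yes y∈S = ∈pair (inj₁ (S∩Y⊆w y∈Y y∈S))
      ...   | no  y∉S = ⊥-elim (survivor-misses-z y∈Y y∉S (∈nbhd⁻ H y∈N))
      Y⊆N[x₀]∪w : Y ⊆ nbhd H x₀ ∪ ⁅ w ⁆
      Y⊆N[x₀]∪w {y} y∈Y with y ∈? S
      ... | yes y∈S = q⊆p∪q _ ⁅ w ⁆ (≡⇒∈⁅⁆ (S∩Y⊆w y∈Y y∈S))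
      ... | no  y∉S = p⊆p∪q ⁅ w ⁆ (∈nbhd⁺ H (joined x₀∈X x₀∉S y∈Y y∉S))

    -- A cut whose vertex c lies in X is impossible: as no side is split,
    -- X ∖ S ⊆ C and Y ∖ S ⊆ D, so both sides have at most three vertices.
    no-cut-through-X : ∀ {X Y} → SparseBipartition H X Y → (κ : ComplementCut H S) → c κ ∈ X → ⊥
    no-cut-through-X {X} {Y} σ κ c∈X = <⇒≱ 7≤n (begin
      n              ≡⟨ sizes σ ⟨
      ∣ X ∣ + ∣ Y ∣  ≤⟨ +-mono-≤ ∣X∣≤3 ∣Y∣≤3 ⟩
      6              ∎)
      where
      open ≤-Reasoning
      X⊆C : ∀ {x} → x ∈ X → x ∉ S → x ∈ C κ
      X⊆C {x} x∈X x∉S = [ id , (λ x∈D → ⊥-elim (no-split σ κ c∈X (c∈C κ) x∈X x∈D)) ]′ (covers κ x x∉S)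
      d∈Y : d κ ∈ Y
      d∈Y = [ (λ d∈X → ⊥-elim (no-split σ κ c∈X (c∈C κ) d∈X (d∈D κ))) , id ]′ (partition σ (d κ))
      Y⊆D : ∀ {y} → y ∈ Y → y ∉ S → y ∈ D κ
      Y⊆D {y} y∈Y y∉S =
        [ (λ y∈C → ⊥-elim (no-split (flipBipartition σ) κ y∈Y y∈C d∈Y (d∈D κ))) , id ]′ (covers κ y y∉S)
      ∣Y∣≤3 : ∣ Y ∣ ≤ 3
      ∣Y∣≤3 = joined-sides-small σ (λ x∈X x∉S y∈Y y∉S → complete κ (X⊆C x∈X x∉S) (Y⊆D y∈Y y∉S))
                c∈X (c∉S κ) d∈Y (d∉S κ)
      ∣X∣≤3 : ∣ X ∣ ≤ 3
      ∣X∣≤3 = joined-sides-small (flipBipartition σ)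
                (λ y∈Y y∉S x∈X x∉S → complete (swapCut κ) (Y⊆D y∈Y y∉S) (X⊆C x∈X x∉S))
                d∈Y (d∉S κ) c∈X (c∉S κ)

    no-cut : ∀ {X Y} → SparseBipartition H X Y → ¬ ComplementCut H S
    no-cut σ κ = [ no-cut-through-X σ κ , no-cut-through-X (flipBipartition σ) κ ]′ (partition σ (c κ))

mainTheorem19 : ∀ (n : ℕ) (H : Graph n) → n ≥ 12 →
    (A : Subset n) →
    ∣ A ∣ ≥ 3 → ∣ ∁ A ∣ ≥ 3 →
    AtMostOneEdgeIn H A → AtMostOneEdgeIn H (∁ A) →
    (∃[ r ] (1 ≤ r × RegularOn H A r)) →
    (∃[ s ] (1 ≤ s × RegularOn H (∁ A) s)) →
    HasNonNeighbourIn H A (∁ A) → HasNonNeighbourIn H (∁ A) A →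
    ComplementThreeConnected H
mainTheorem19 n H n≥12 A large-A large-∁A sparse-A sparse-∁A (r , _ , regular-A) (s , _ , regular-∁A)
              nonNbr-A nonNbr-∁A = ≤-trans (m≤m+n 4 8) n≥12 , connected
  where
  σ : SparseBipartition H A (∁ A)
  σ = record
    { partition = ∈-or-∈∁ A ; disjoint = λ x∈A x∈∁A → x∈∁p⇒x∉p x∈∁A x∈A ; sizes = ∣p∣+∣∁p∣≡n A
    ; large-X = large-A ; large-Y = large-∁A ; sparse-X = sparse-A ; sparse-Y = sparse-∁A
    ; regular-X = r , regular-A ; regular-Y = s , regular-∁A
    ; nonNeighbour-X = nonNbr-A ; nonNeighbour-Y = nonNbr-∁A }
  connected : ∀ S → ∣ S ∣ ≤ 2 → ∀ u v → u ∉ S → v ∉ S → CoWalk H S u v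
  connected S ∣S∣≤2 u v u∉S v∉S =
    [ id , ⊥-elim ∘ no-cut H (≤-trans (m≤m+n 7 5) n≥12) S ∣S∣≤2 σ ]′ (walk-or-cut H S u v u∉S v∉S)
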